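{- Let $n\ge1$ and let $\operatorname{aff}:[n]\to[n]$ be any map. Then both lattices $\Pi^{\exists}_{\operatorname{aff}}$ and $\Pi^{\forall}_{\operatorname{aff}}$ are comodernistic.
   Context: $\Pi_n$ is the lattice of set partitions of $[n]=\{1,\dots,n\}$ ordered by refinement. Define $\Pi^{\forall}_{\operatorname{aff}}=\{\pi\in\Pi_n: \text{every non-singleton block } B \text{ of } \pi \text{ has } |B|\ge\operatorname{aff}(x) \text{ for every } x\in B\}$ and $\Pi^{\exists}_{\operatorname{aff}}=\{\pi\in\Pi_n: \text{every non-singleton block } B \text{ of } \pi \text{ contains some } x \text{ with } |B|\ge\operatorname{aff}(x)\}$, ordered as subposets of $\Pi_n$ (they are join subsemilattices of $\Pi_n$, hence lattices). An element $m$ of a lattice $L$ is left-modular if $(x\vee m)\wedge y=x\vee(m\wedge y)$ for all $x<y$; a lattice is comodernistic if every interval $[u,v]$ has a coatom that is left-modular in $[u,v]$. -}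

module Defs where

open import Data.Nat using (ℕ; zero; suc; _+_; _≤_)
open import Data.Fin using (Fin; zero; suc; toℕ)
open import Data.Bool using (Bool; true; false; if_then_else_)
open import Data.Product using (Σ; _×_; _,_)
open import Relation.Nullary using (¬_)
open import Relation.Binary.PropositionalEquality using (_≡_)

-- A set partition of [n] (encoded as Fin n), represented by its
-- "same block" relation: a Bool-valued equivalence relation on Fin n.
record Partition (n : ℕ) : Set where
  field
    rel   : Fin n → Fin n → Bool
    reflx : ∀ x → rel x x ≡ true
    symm  : ∀ x y → rel x y ≡ true → rel y x ≡ true
    trans : ∀ x y z → rel x y ≡ true → rel y z ≡ true → rel x z ≡ true
open Partition public

SameBlock : ∀ {n} → Partition n → Fin n → Fin n → Set
SameBlock π x y = rel π x y ≡ true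

countB : ∀ {n} → (Fin n → Bool) → ℕ
countB {zero}  f = 0
countB {suc n} f = (if f zero then 1 else 0) + countB (λ i → f (suc i))

blockSize : ∀ {n} → Partition n → Fin n → ℕ
blockSize π x = countB (rel π x)

_⊑_ : ∀ {n} → Partition n → Partition n → Set
π ⊑ σ = ∀ x y → SameBlock π x y → SameBlock σ x y

_≈_ : ∀ {n} → Partition n → Partition n → Set
π ≈ σ = π ⊑ σ × σ ⊑ π

_⊏_ : ∀ {n} → Partition n → Partition n → Set
π ⊏ σ = π ⊑ σ × ¬ (σ ⊑ π)

-- aff : [n] → [n]; with [n] encoded as Fin n, the value of aff at x is
-- the natural number suc (toℕ (aff x)) ∈ {1,…,n}.
affVal : ∀ {n} → (Fin n → Fin n) → Fin n → ℕ
affVal aff x = suc (toℕ (aff x))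

PiForall : ∀ {n} → (Fin n → Fin n) → Partition n → Set
PiForall aff π = ∀ x → 2 ≤ blockSize π x →
  ∀ y → SameBlock π x y → affVal aff y ≤ blockSize π x

PiExists : ∀ {n} → (Fin n → Fin n) → Partition n → Set
PiExists aff π = ∀ x → 2 ≤ blockSize π x →
  Σ _ λ y → SameBlock π x y × affVal aff y ≤ blockSize π x

Subposet : ℕ → Set₁
Subposet n = Partition n → Set

IsUB : ∀ {n} → Subposet n → Partition n → Partition n → Partition n → Set
IsUB Q a b c = Q c × a ⊑ c × b ⊑ c

IsLB : ∀ {n} → Subposet n → Partition n → Partition n → Partition n → Set
IsLB Q a b c = Q c × c ⊑ a × c ⊑ b

IsJoin : ∀ {n} → Subposet n → Partition n → Partition n → Partition n → Set
IsJoin Q a b c = IsUB Q a b c × (∀ d → IsUB Q a b d → c ⊑ d)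

IsMeet : ∀ {n} → Subposet n → Partition n → Partition n → Partition n → Set
IsMeet Q a b c = IsLB Q a b c × (∀ d → IsLB Q a b d → d ⊑ c)

IsLattice : ∀ {n} → Subposet n → Set
IsLattice Q = ∀ a b → Q a → Q b →
  Σ _ (IsJoin Q a b) × Σ _ (IsMeet Q a b)

Interval : ∀ {n} → Subposet n → Partition n → Partition n → Subposet n
Interval Q u v p = Q p × u ⊑ p × p ⊑ v

LeftModular : ∀ {n} → Subposet n → Partition n → Set
LeftModular Q m = ∀ x y → Q x → Q y → x ⊏ y →
  ∀ j k l r → IsJoin Q x m j → IsMeet Q j y k →
              IsMeet Q m y l → IsJoin Q x l r → k ≈ r

IsCoatom : ∀ {n} → Subposet n → Partition n → Partition n → Set
IsCoatom Q v m = Q m × m ⊏ v × (∀ w → Q w → m ⊏ w → ¬ (w ⊏ v))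

Comodernistic : ∀ {n} → Subposet n → Set
Comodernistic Q = IsLattice Q ×
  (∀ u v → Q u → Q v → u ⊏ v →
     Σ _ λ m → IsCoatom (Interval Q u v) v m × LeftModular (Interval Q u v) m)

module Submission where

-- Both families are join-closed subsets of Π_n containing the discrete partition, and
-- membership is decided block by block. Given u < v in the family, pick a block of v
-- that is not a block of u and in it a pivot d: a u-singleton of largest aff, if the
-- block contains u-singletons at all. Let D be the u-block of d and t the partition v
-- with the block of d split into D and the rest; the coatom m is the largest member
-- of [u, t]. Both maximality of m and its left-modularity reduce to one exchange
-- property: whenever x ⊑ y in [u, v] and x ⋢ t, some member l of [u, t] below y has
-- y ⊑ x ∨ l. If y with its block Y of d split at D is a member, take it for l.
-- Otherwise S = Y ∖ D is an inadmissible block, and the choice of d forces D = {d}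
-- and |S| < |X| for the x-block X of d; so Y ⊆ X, and l = y with Y refined by u works.

open import Defs
open import Data.Bool using (Bool; true; false; not; _∧_; if_then_else_)
open import Data.Bool.Properties using (⇔→≡; ¬-not; not-injective) renaming (_≟_ to _≟ᵇ_)
open import Data.Nat using (ℕ; zero; suc; _+_; _*_; _≤_; _<_; z≤n; s≤s; _≤?_; _<?_)
open import Data.Nat.Properties
  using (≤-refl; ≤-reflexive; ≤-trans; <-≤-trans; <⇒≱; ≰⇒>; ≮⇒≥; ≤-pred; +-mono-≤; +-suc; m≤n⇒m≤1+n; m≤n+m)
open import Data.Fin using (Fin; zero; suc; combine; remQuot)
open import Data.Fin.Subset using (Subset)
open import Data.Fin.Subset.Properties using (anySubset?)
open import Data.Fin.Properties using (any?; all?; remQuot-combine; suc-injective) renaming (_≟_ to _≟ᶠ_)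
open import Data.Vec using (lookup; tabulate)
open import Data.Vec.Properties using (lookup∘tabulate)
open import Data.Product using (Σ; ∃; _×_; _,_; proj₁; proj₂; uncurry)
open import Data.Sum using (_⊎_; inj₁; inj₂)
open import Data.Empty using (⊥-elim)
open import Function.Bundles using (mk⇔)
open import Relation.Nullary using (¬_; Dec; yes; no; does; contradiction)
open import Relation.Nullary.Decidable using (_×-dec_; _→-dec_; ¬?; map′; dec-true; does-⇔; decidable-stable)
open import Relation.Binary.Definitions using (_Respects_)
open import Relation.Unary using (Decidable)
open import Data.List using (List; filter; allFin)
open import Data.List.Extrema.Nat using (argmax; argmax-all; f[xs]≤f[argmax])
import Data.List.Relation.Unary.All as All
open import Data.List.Relation.Unary.All.Properties using (all-filter)
open import Data.List.Membership.Propositional.Properties using (∈-filter⁺; ∈-allFin)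
open import Relation.Binary.PropositionalEquality as ≡ using (_≡_; _≢_; refl; sym; cong; subst)

private
  variable
    n : ℕ

∧-intro : ∀ {a b} → a ≡ true → b ≡ true → a ∧ b ≡ true
∧-intro refl refl = refl

∧-elimˡ : ∀ {a b} → a ∧ b ≡ true → a ≡ true
∧-elimˡ {true} _ = refl

∧-elimʳ : ∀ {a b} → a ∧ b ≡ true → b ≡ true
∧-elimʳ {true} p = p

true≢false : ∀ {b} → b ≡ true → b ≢ false
true≢false refl ()

does-true⇒ : ∀ {A : Set} (a? : Dec A) → does a? ≡ true → A
does-true⇒ (yes a) _ = a

≡true-ext : ∀ {a b} → (a ≡ true → b ≡ true) → (b ≡ true → a ≡ true) → a ≡ b
≡true-ext f g = ⇔→≡ (mk⇔ f g)

-- Counting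

infix 4 _⊆_
_⊆_ : (Fin n → Bool) → (Fin n → Bool) → Set
f ⊆ g = ∀ i → f i ≡ true → g i ≡ true

_∖_ : (Fin n → Bool) → (Fin n → Bool) → Fin n → Bool
(f ∖ g) i = f i ∧ not (g i)

countB-cong : {f g : Fin n → Bool} → (∀ i → f i ≡ g i) → countB f ≡ countB g
countB-cong {zero}  eq = refl
countB-cong {suc n} eq rewrite eq zero = cong (_ +_) (countB-cong (λ i → eq (suc i)))

countB-mono : {f g : Fin n → Bool} → f ⊆ g → countB f ≤ countB g
countB-mono {zero}            f⊆g = z≤n
countB-mono {suc n} {f} {g} f⊆g with f zero in fz | g zero in gz
... | false | false = countB-mono (λ i → f⊆g (suc i))
... | false | true  = m≤n⇒m≤1+n (countB-mono (λ i → f⊆g (suc i)))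
... | true  | false = ⊥-elim (true≢false (f⊆g zero fz) gz)
... | true  | true  = s≤s (countB-mono (λ i → f⊆g (suc i)))

countB-pos : {f : Fin n → Bool} (i : Fin n) → f i ≡ true → 1 ≤ countB f
countB-pos           zero    fi rewrite fi = s≤s z≤n
countB-pos {f = f} (suc i) fi = ≤-trans (countB-pos i fi) (m≤n+m _ (if f zero then 1 else 0))

countB-≥2 : {f : Fin n → Bool} (i j : Fin n) → f i ≡ true → f j ≡ true → i ≢ j → 2 ≤ countB f
countB-≥2         zero    zero    _  _  i≢j = contradiction refl i≢j
countB-≥2         zero    (suc j) fi fj _   rewrite fi = s≤s (countB-pos j fj)
countB-≥2         (suc i) zero    fi fj _   rewrite fj = s≤s (countB-pos i fi)
countB-≥2 {f = f} (suc i) (suc j) fi fj i≢j =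
  ≤-trans (countB-≥2 i j fi fj (λ i≡j → i≢j (cong suc i≡j))) (m≤n+m _ (if f zero then 1 else 0))

countB≤1⇒unique : {f : Fin n → Bool} → countB f ≤ 1 → ∀ i j → f i ≡ true → f j ≡ true → i ≡ j
countB≤1⇒unique ≤1 i j fi fj with i ≟ᶠ j
... | yes i≡j = i≡j
... | no  i≢j = ⊥-elim (<⇒≱ (countB-≥2 i j fi fj i≢j) ≤1)

countB-empty : {f : Fin n → Bool} → (∀ i → f i ≡ false) → countB f ≡ 0
countB-empty {zero}  _     = refl
countB-empty {suc n} empty rewrite empty zero = countB-empty (λ i → empty (suc i))

unique⇒countB≤1 : {f : Fin n → Bool} → (∀ i j → f i ≡ true → f j ≡ true → i ≡ j) → countB f ≤ 1
unique⇒countB≤1 {zero}          _    = z≤n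
unique⇒countB≤1 {suc n} {f} uniq with f zero in fz
... | false = unique⇒countB≤1 (λ i j fi fj → suc-injective (uniq (suc i) (suc j) fi fj))
... | true  = s≤s (≤-reflexive (countB-empty (λ i → ¬-not (λ fi → 0≢suc (uniq zero (suc i) fz fi)))))
  where 0≢suc : ∀ {i : Fin n} → zero ≢ suc i
        0≢suc ()

countB-mono-< : {f g : Fin n → Bool} → f ⊆ g → ∀ j → g j ≡ true → f j ≡ false → countB f < countB g
countB-mono-< f⊆g zero    gj fj rewrite gj | fj = s≤s (countB-mono (λ i → f⊆g (suc i)))
countB-mono-< {f = f} {g} f⊆g (suc j) gj fj with f zero in fz | g zero in gz
... | false | false = countB-mono-< (λ i → f⊆g (suc i)) j gj fj
... | false | true  = m≤n⇒m≤1+n (countB-mono-< (λ i → f⊆g (suc i)) j gj fj)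
... | true  | false = ⊥-elim (true≢false (f⊆g zero fz) gz)
... | true  | true  = s≤s (countB-mono-< (λ i → f⊆g (suc i)) j gj fj)

countB-⊆-antisym : {f g : Fin n → Bool} → f ⊆ g → countB g ≤ countB f → g ⊆ f
countB-⊆-antisym {f = f} f⊆g ≥ j gj with f j in fj
... | true  = refl
... | false = ⊥-elim (<⇒≱ (countB-mono-< f⊆g j gj fj) ≥)

countB-split : (f g : Fin n → Bool) → countB f ≡ countB (λ i → f i ∧ g i) + countB (f ∖ g)
countB-split {zero}  f g = refl
countB-split {suc n} f g with f zero | g zero
... | true  | true  = cong suc (countB-split (λ i → f (suc i)) (λ i → g (suc i)))
... | true  | false = ≡.trans (cong suc (countB-split (λ i → f (suc i)) (λ i → g (suc i)))) (sym (+-suc _ _))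
... | false | _     = countB-split (λ i → f (suc i)) (λ i → g (suc i))

⊑-refl : {p : Partition n} → p ⊑ p
⊑-refl _ _ pab = pab

⊑-trans : {p q r : Partition n} → p ⊑ q → q ⊑ r → p ⊑ r
⊑-trans p⊑q q⊑r a b pab = q⊑r a b (p⊑q a b pab)

≈⇒rel≡ : {p q : Partition n} → p ≈ q → ∀ a b → rel p a b ≡ rel q a b
≈⇒rel≡ (p⊑q , q⊑p) a b = ≡true-ext (p⊑q a b) (q⊑p a b)

block-≡ : (p : Partition n) {a c : Fin n} → SameBlock p a c → ∀ b → rel p a b ≡ rel p c b
block-≡ p {a} {c} pac b = ≡true-ext (trans p c a b (symm p a c pac)) (trans p a c b pac)

blockSize-≡ : (p : Partition n) {a c : Fin n} → SameBlock p a c → blockSize p a ≡ blockSize p c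
blockSize-≡ p pac = countB-cong (block-≡ p pac)

blockSize-mono : {p q : Partition n} → p ⊑ q → ∀ a → blockSize p a ≤ blockSize q a
blockSize-mono p⊑q a = countB-mono (p⊑q a)

_⊑?_ : (p q : Partition n) → Dec (p ⊑ q)
p ⊑? q = all? (λ a → all? (λ b → (rel p a b ≟ᵇ true) →-dec (rel q a b ≟ᵇ true)))

⋢⇒separated : {p q : Partition n} → ¬ (p ⊑ q) →
              ∃ λ a → ∃ λ b → SameBlock p a b × rel q a b ≡ false
⋢⇒separated {p = p} {q} p⋢q
  with any? (λ a → any? (λ b → (rel p a b ≟ᵇ true) ×-dec (rel q a b ≟ᵇ false)))
... | yes (a , b , pab , qab) = a , b , pab , qab
... | no  none = ⊥-elim (p⋢q λ a b pab → ¬-not (λ qab → none (a , b , pab , qab)))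

discrete : Partition n
discrete = record
  { rel   = λ a b → does (a ≟ᶠ b)
  ; reflx = λ a → dec-true (a ≟ᶠ a) refl
  ; symm  = λ a b ab → dec-true (b ≟ᶠ a) (sym (does-true⇒ (a ≟ᶠ b) ab))
  ; trans = λ a b c ab bc →
      dec-true (a ≟ᶠ c) (≡.trans (does-true⇒ (a ≟ᶠ b) ab) (does-true⇒ (b ≟ᶠ c) bc))
  }

discrete-least : (p : Partition n) → discrete ⊑ p
discrete-least p a b ab = subst (SameBlock p a) (does-true⇒ (a ≟ᶠ b) ab) (reflx p a)

blockSize-discrete : (a : Fin n) → blockSize discrete a ≤ 1
blockSize-discrete a = unique⇒countB≤1 λ i j ai aj →
  ≡.trans (sym (does-true⇒ (a ≟ᶠ i) ai)) (does-true⇒ (a ≟ᶠ j) aj)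

infixr 30 _∧ₚ_
_∧ₚ_ : Partition n → Partition n → Partition n
p ∧ₚ q = record
  { rel   = λ a b → rel p a b ∧ rel q a b
  ; reflx = λ a → ∧-intro (reflx p a) (reflx q a)
  ; symm  = λ a b ab → ∧-intro (symm p a b (∧-elimˡ ab)) (symm q a b (∧-elimʳ ab))
  ; trans = λ a b c ab bc →
      ∧-intro (trans p a b c (∧-elimˡ ab) (∧-elimˡ bc)) (trans q a b c (∧-elimʳ ab) (∧-elimʳ bc))
  }

∧ₚ-lowerˡ : (p q : Partition n) → p ∧ₚ q ⊑ p
∧ₚ-lowerˡ p q a b ab = ∧-elimˡ ab

∧ₚ-lowerʳ : (p q : Partition n) → p ∧ₚ q ⊑ q
∧ₚ-lowerʳ p q a b ab = ∧-elimʳ {rel p a b} ab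

∧ₚ-greatest : {p q r : Partition n} → r ⊑ p → r ⊑ q → r ⊑ p ∧ₚ q
∧ₚ-greatest r⊑p r⊑q a b rab = ∧-intro (r⊑p a b rab) (r⊑q a b rab)

∧ₚ-monoˡ : {p p′ : Partition n} (q : Partition n) → p ⊑ p′ → p ∧ₚ q ⊑ p′ ∧ₚ q
∧ₚ-monoˡ q p⊑p′ a b pqab = ∧-intro (p⊑p′ a b (∧-elimˡ pqab)) (∧-elimʳ pqab)

split : (Fin n → Bool) → Partition n
split D = record
  { rel   = λ a b → does (D a ≟ᵇ D b)
  ; reflx = λ a → dec-true (D a ≟ᵇ D a) refl
  ; symm  = λ a b ab → dec-true (D b ≟ᵇ D a) (sym (does-true⇒ (D a ≟ᵇ D b) ab))
  ; trans = λ a b c ab bc →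
      dec-true (D a ≟ᵇ D c) (≡.trans (does-true⇒ (D a ≟ᵇ D b) ab) (does-true⇒ (D b ≟ᵇ D c) bc))
  }

split-intro : (D : Fin n → Bool) {a b : Fin n} → D a ≡ D b → SameBlock (split D) a b
split-intro D {a} {b} = dec-true (D a ≟ᵇ D b)

split-elim : (D : Fin n → Bool) {a b : Fin n} → SameBlock (split D) a b → D a ≡ D b
split-elim D {a} {b} = does-true⇒ (D a ≟ᵇ D b)

membership-≡ : (p : Partition n) (d : Fin n) {a b : Fin n} → SameBlock p a b → rel p d a ≡ rel p d b
membership-≡ p d {a} {b} pab =
  ≡true-ext (λ pda → trans p d a b pda pab) (λ pdb → trans p d b a pdb (symm p a b pab))

⊑-split-block : (p : Partition n) (d : Fin n) → p ⊑ split (rel p d)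
⊑-split-block p d a b pab = split-intro (rel p d) (membership-≡ p d pab)

rel≡⇒≈ : (p q : Partition n) → (∀ a b → rel p a b ≡ rel q a b) → p ≈ q
rel≡⇒≈ _ _ eq = (λ a b pab → ≡.trans (sym (eq a b)) pab) , (λ a b qab → ≡.trans (eq a b) qab)

≈-sym : {p q : Partition n} → p ≈ q → q ≈ p
≈-sym (p⊑q , q⊑p) = q⊑p , p⊑q

⊑-respˡ : (a : Partition n) → (λ p → p ⊑ a) Respects _≈_
⊑-respˡ a {p} {q} (_ , q⊑p) p⊑a = ⊑-trans {p = q} {p} {a} q⊑p p⊑a

⊑-respʳ : (a : Partition n) → (λ p → a ⊑ p) Respects _≈_
⊑-respʳ a {p} {q} (p⊑q , _) a⊑p = ⊑-trans {p = a} {p} {q} a⊑p p⊑q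

-- Exhaustive search over partitions

IsEquivalenceᵇ : (Fin n → Fin n → Bool) → Set
IsEquivalenceᵇ r = (∀ a → r a a ≡ true)
                 × (∀ a b → r a b ≡ true → r b a ≡ true)
                 × (∀ a b c → r a b ≡ true → r b c ≡ true → r a c ≡ true)

isEquivalenceᵇ? : (r : Fin n → Fin n → Bool) → Dec (IsEquivalenceᵇ r)
isEquivalenceᵇ? r =
  all? (λ a → r a a ≟ᵇ true) ×-dec
  all? (λ a → all? λ b → (r a b ≟ᵇ true) →-dec (r b a ≟ᵇ true)) ×-dec
  all? (λ a → all? λ b → all? λ c → (r a b ≟ᵇ true) →-dec ((r b c ≟ᵇ true) →-dec (r a c ≟ᵇ true)))

fromEquivalenceᵇ : (r : Fin n → Fin n → Bool) → IsEquivalenceᵇ r → Partition n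
fromEquivalenceᵇ r (r-refl , r-sym , r-trans) =
  record { rel = r ; reflx = r-refl ; symm = r-sym ; trans = r-trans }

isEquivalenceᵇ-≗ : (p : Partition n) {r : Fin n → Fin n → Bool} →
                   (∀ a b → r a b ≡ rel p a b) → IsEquivalenceᵇ r
isEquivalenceᵇ-≗ p {r} r≗p = r-refl , r-sym , r-trans
  where
  to : ∀ {a b} → r a b ≡ true → SameBlock p a b
  to {a} {b} rab = ≡.trans (sym (r≗p a b)) rab
  from : ∀ {a b} → SameBlock p a b → r a b ≡ true
  from {a} {b} pab = ≡.trans (r≗p a b) pab
  r-refl : ∀ a → r a a ≡ true
  r-refl a = from (reflx p a)
  r-sym : ∀ a b → r a b ≡ true → r b a ≡ true
  r-sym a b rab = from (symm p a b (to rab))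
  r-trans : ∀ a b c → r a b ≡ true → r b c ≡ true → r a c ≡ true
  r-trans a b c rab rbc = from (trans p a b c (to rab) (to rbc))

-- A relation on Fin n is stored as a subset of Fin (n * n), which makes
-- the partitions of Fin n exhaustively searchable with anySubset?.
lookupRel : Subset (n * n) → Fin n → Fin n → Bool
lookupRel s a b = lookup s (combine a b)

tabulateRel : Partition n → Subset (n * n)
tabulateRel {n} p = tabulate (λ i → uncurry (rel p) (remQuot n i))

lookupRel-tabulateRel : (p : Partition n) (a b : Fin n) → lookupRel {n} (tabulateRel p) a b ≡ rel p a b
lookupRel-tabulateRel {n} p a b =
  ≡.trans (lookup∘tabulate _ (combine a b)) (cong (uncurry (rel p)) (remQuot-combine a b))

abstract
  any-partition? : {P : Partition n → Set} → P Respects _≈_ → (∀ p → Dec (P p)) → Dec (∃ P)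
  any-partition? {n} {P} resp P? = map′ decode encode (anySubset? Pˢ?)
    where
    Pˢ : Subset (n * n) → Set
    Pˢ s = Σ (IsEquivalenceᵇ (lookupRel {n} s)) λ e → P (fromEquivalenceᵇ _ e)
    Pˢ? : ∀ s → Dec (Pˢ s)
    Pˢ? s with isEquivalenceᵇ? (lookupRel {n} s)
    ... | no  ¬e = no (λ (e , _) → ¬e e)
    ... | yes e  = map′ (e ,_) (λ (e′ , Pp) → resp (same-rel e′) Pp) (P? (fromEquivalenceᵇ _ e))
      where
      same-rel : ∀ e′ → fromEquivalenceᵇ (lookupRel s) e′ ≈ fromEquivalenceᵇ (lookupRel s) e
      same-rel e′ = rel≡⇒≈ (fromEquivalenceᵇ _ e′) (fromEquivalenceᵇ _ e) λ _ _ → refl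
    decode : ∃ Pˢ → ∃ P
    decode (s , e , Pp) = fromEquivalenceᵇ _ e , Pp
    encode : ∃ P → ∃ Pˢ
    encode (p , Pp) = tabulateRel p , e , resp p≈ Pp
      where
      e : IsEquivalenceᵇ (lookupRel {n} (tabulateRel p))
      e = isEquivalenceᵇ-≗ p (lookupRel-tabulateRel p)
      p≈ : p ≈ fromEquivalenceᵇ _ e
      p≈ = rel≡⇒≈ p (fromEquivalenceᵇ _ e) λ a b → sym (lookupRel-tabulateRel p a b)

  all-partitions? : {P : Partition n → Set} → P Respects _≈_ → (∀ p → Dec (P p)) → Dec (∀ p → P p)
  all-partitions? {P = P} resp P?
    with any-partition? {P = λ p → ¬ P p} (λ {p} {q} p≈q ¬Pp Pq → ¬Pp (resp (≈-sym {p = p} {q} p≈q) Pq))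
                        (λ p → ¬? (P? p))
  ... | yes (p , ¬Pp) = no (λ all → ¬Pp (all p))
  ... | no  none      = yes (λ p → decidable-stable (P? p) (λ ¬Pp → none (p , ¬Pp)))

infixr 25 _∨ₚ_

-- The intersection of all common upper bounds.
abstract
  RelatedAbove : (p q : Partition n) → Fin n → Fin n → Set
  RelatedAbove {n} p q a b = ∀ (e : Partition n) → p ⊑ e → q ⊑ e → SameBlock e a b

  relatedAbove? : (p q : Partition n) (a b : Fin n) → Dec (RelatedAbove p q a b)
  relatedAbove? {n} p q a b =
    all-partitions? {P = λ e → p ⊑ e → q ⊑ e → SameBlock e a b} (λ {e} {e′} → resp {e} {e′})
                    (λ e → (p ⊑? e) →-dec ((q ⊑? e) →-dec (rel e a b ≟ᵇ true)))
    where
    resp : (λ (e : Partition n) → p ⊑ e → q ⊑ e → SameBlock e a b) Respects _≈_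
    resp {e} {e′} (e⊑e′ , e′⊑e) rel-e p⊑e′ q⊑e′ =
      e⊑e′ a b (rel-e (⊑-trans {p = p} {e′} {e} p⊑e′ e′⊑e) (⊑-trans {p = q} {e′} {e} q⊑e′ e′⊑e))

  _∨ₚ_ : Partition n → Partition n → Partition n
  p ∨ₚ q = record
    { rel   = λ a b → does (relatedAbove? p q a b)
    ; reflx = λ a → dec-true (relatedAbove? p q a a) λ e _ _ → reflx e a
    ; symm  = λ a b ab → dec-true (relatedAbove? p q b a) λ e p⊑e q⊑e →
        symm e a b (does-true⇒ (relatedAbove? p q a b) ab e p⊑e q⊑e)
    ; trans = λ a b c ab bc → dec-true (relatedAbove? p q a c) λ e p⊑e q⊑e →
        trans e a b c (does-true⇒ (relatedAbove? p q a b) ab e p⊑e q⊑e)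
                      (does-true⇒ (relatedAbove? p q b c) bc e p⊑e q⊑e)
    }

  ∨ₚ-upperˡ : (p q : Partition n) → p ⊑ p ∨ₚ q
  ∨ₚ-upperˡ p q a b pab = dec-true (relatedAbove? p q a b) λ e p⊑e _ → p⊑e a b pab

  ∨ₚ-upperʳ : (p q : Partition n) → q ⊑ p ∨ₚ q
  ∨ₚ-upperʳ p q a b qab = dec-true (relatedAbove? p q a b) λ e _ q⊑e → q⊑e a b qab

  ∨ₚ-least : {p q r : Partition n} → p ⊑ r → q ⊑ r → p ∨ₚ q ⊑ r
  ∨ₚ-least {p = p} {q} {r} p⊑r q⊑r a b pqab = does-true⇒ (relatedAbove? p q a b) pqab r p⊑r q⊑r

isolated-⊑-split : (p : Partition n) (a : Fin n) → blockSize p a ≤ 1 → p ⊑ split (rel discrete a)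
isolated-⊑-split p a ≤1 x y pxy = split-intro (rel discrete a) (does-⇔ (mk⇔ to from) (a ≟ᶠ x) (a ≟ᶠ y))
  where
  to : a ≡ x → a ≡ y
  to refl = countB≤1⇒unique ≤1 a y (reflx p a) pxy
  from : a ≡ y → a ≡ x
  from refl = countB≤1⇒unique ≤1 a x (reflx p a) (symm p x a pxy)

blockSize-∨ₚ≤1 : (p q : Partition n) (a : Fin n) →
                 blockSize p a ≤ 1 → blockSize q a ≤ 1 → blockSize (p ∨ₚ q) a ≤ 1
blockSize-∨ₚ≤1 p q a p≤1 q≤1 = unique⇒countB≤1 λ i j ai aj → ≡.trans (sym (isolated i ai)) (isolated j aj)
  where
  isolated : ∀ b → SameBlock (p ∨ₚ q) a b → a ≡ b
  isolated b ab = does-true⇒ (a ≟ᶠ b) (≡.trans (sym (split-elim (rel discrete a) a~b)) (reflx discrete a))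
    where
    a~b : SameBlock (split (rel discrete a)) a b
    a~b = ∨ₚ-least {p = p} {q} {split (rel discrete a)}
            (isolated-⊑-split p a p≤1) (isolated-⊑-split q a q≤1) a b ab

∨ₚ-nontrivial : (p q : Partition n) (a : Fin n) →
                2 ≤ blockSize (p ∨ₚ q) a → 2 ≤ blockSize p a ⊎ 2 ≤ blockSize q a
∨ₚ-nontrivial p q a 2≤ with 2 ≤? blockSize p a | 2 ≤? blockSize q a
... | yes 2≤p | _       = inj₁ 2≤p
... | no  _   | yes 2≤q = inj₂ 2≤q
... | no  2≰p | no  2≰q =
  ⊥-elim (<⇒≱ 2≤ (blockSize-∨ₚ≤1 p q a (≤-pred (≰⇒> 2≰p)) (≤-pred (≰⇒> 2≰q))))

⋁ : ∀ {k} → Partition n → (Fin k → Partition n) → Partition n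
⋁ {k = zero}  p₀ F = p₀
⋁ {k = suc k} p₀ F = F zero ∨ₚ ⋁ p₀ (λ i → F (suc i))

⋁-upper : ∀ {k} (p₀ : Partition n) (F : Fin k → Partition n) i → F i ⊑ ⋁ p₀ F
⋁-upper p₀ F zero    = ∨ₚ-upperˡ (F zero) (⋁ p₀ (λ j → F (suc j)))
⋁-upper p₀ F (suc i) = ⊑-trans {p = F (suc i)} {⋁ p₀ (λ j → F (suc j))} {⋁ p₀ F}
  (⋁-upper p₀ (λ j → F (suc j)) i) (∨ₚ-upperʳ (F zero) (⋁ p₀ (λ j → F (suc j))))

⋁-closed : {P : Partition n → Set} → (∀ {p q} → P p → P q → P (p ∨ₚ q)) →
           ∀ {k p₀} → P p₀ → (F : Fin k → Partition n) → (∀ i → P (F i)) → P (⋁ p₀ F)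
⋁-closed ∨-closed {k = zero}  P₀ F PF = P₀
⋁-closed ∨-closed {k = suc k} {p₀} P₀ F PF =
  ∨-closed {F zero} {⋁ p₀ (λ i → F (suc i))} (PF zero)
    (⋁-closed ∨-closed {p₀ = p₀} P₀ (λ i → F (suc i)) (λ i → PF (suc i)))

-- The greatest member is the join, over all pairs (a , b), of some member relating a and b.
greatest : {P : Partition n → Set} → P Respects _≈_ → (∀ p → Dec (P p)) →
           (∀ {p q} → P p → P q → P (p ∨ₚ q)) → ∀ {p₀} → P p₀ →
           Σ (Partition n) λ g → P g × (∀ p → P p → p ⊑ g)
greatest {n} {P} resp P? ∨-closed {p₀} P₀ = g , Pg , g-greatest
  where
  member? : ∀ a b → Dec (∃ λ p → P p × SameBlock p a b)
  member? a b = any-partition? {P = λ p → P p × SameBlock p a b}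
    (λ {p} {q} p≈q (Pp , pab) → resp p≈q Pp , proj₁ p≈q a b pab)
    (λ p → P? p ×-dec (rel p a b ≟ᵇ true))
  W : Fin n → Fin n → Partition n
  W a b with member? a b
  ... | yes (p , _) = p
  ... | no  _       = p₀
  PW : ∀ a b → P (W a b)
  PW a b with member? a b
  ... | yes (_ , Pp , _) = Pp
  ... | no  _            = P₀
  W-relates : ∀ a b p → P p → SameBlock p a b → SameBlock (W a b) a b
  W-relates a b p Pp pab with member? a b
  ... | yes (_ , _ , Wab) = Wab
  ... | no  none          = ⊥-elim (none (p , Pp , pab))
  g : Partition n
  g = ⋁ p₀ λ a → ⋁ p₀ (W a)
  Pg : P g
  Pg = ⋁-closed {P = P} ∨-closed {p₀ = p₀} P₀ (λ a → ⋁ p₀ (W a)) λ a →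
       ⋁-closed {P = P} ∨-closed {p₀ = p₀} P₀ (W a) (PW a)
  g-greatest : ∀ p → P p → p ⊑ g
  g-greatest p Pp a b pab =
    ⋁-upper p₀ (λ a → ⋁ p₀ (W a)) a a b (⋁-upper p₀ (W a) b a b (W-relates a b p Pp pab))

Blockwise : ((Fin n → Bool) → Set) → Partition n → Set
Blockwise φ π = ∀ x → φ (rel π x)

module _ (q p : Partition n) (p⊑q : p ⊑ q) (d : Fin n) where

  private
    r : Fin n → Fin n → Bool
    r a b = if rel q d a then rel p a b else rel q a b

    inside : ∀ {a} → rel q d a ≡ true → ∀ b → r a b ≡ rel p a b
    inside qda b rewrite qda = refl

    outside : ∀ {a} → rel q d a ≡ false → ∀ b → r a b ≡ rel q a b
    outside qda b rewrite qda = refl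

    r-refl : ∀ a → r a a ≡ true
    r-refl a with rel q d a in qda
    ... | true  = reflx p a
    ... | false = reflx q a

    r-sym : ∀ a b → r a b ≡ true → r b a ≡ true
    r-sym a b rab with rel q d a in qda
    ... | true  = ≡.trans (inside (≡.trans (sym (membership-≡ q d (p⊑q a b rab))) qda) a) (symm p a b rab)
    ... | false = ≡.trans (outside (≡.trans (sym (membership-≡ q d rab)) qda) a) (symm q a b rab)

    r-trans : ∀ a b c → r a b ≡ true → r b c ≡ true → r a c ≡ true
    r-trans a b c rab rbc with rel q d a in qda
    ... | true  = trans p a b c rab (≡.trans (sym (inside qdb c)) rbc)
      where
      qdb : rel q d b ≡ true
      qdb = ≡.trans (sym (membership-≡ q d (p⊑q a b rab))) qda
    ... | false = trans q a b c rab (≡.trans (sym (outside qdb c)) rbc)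
      where
      qdb : rel q d b ≡ false
      qdb = ≡.trans (sym (membership-≡ q d rab)) qda

  refineAt : Partition n
  refineAt = record { rel = r ; reflx = r-refl ; symm = r-sym ; trans = r-trans }

  ⊑-refineAt : p ⊑ refineAt
  ⊑-refineAt a b pab with rel q d a
  ... | true  = pab
  ... | false = p⊑q a b pab

  refineAt-⊑ : refineAt ⊑ q
  refineAt-⊑ a b rab with rel q d a
  ... | true  = p⊑q a b rab
  ... | false = rab

  refineAt-⊑-split : refineAt ⊑ split (rel p d)
  refineAt-⊑-split a b rab with rel q d a in qda
  ... | true  = ⊑-split-block p d a b rab
  ... | false = split-intro (rel p d) (≡.trans (outside-p qda) (sym (outside-p qdb)))
    where
    qdb : rel q d b ≡ false
    qdb = ≡.trans (sym (membership-≡ q d rab)) qda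
    outside-p : ∀ {c} → rel q d c ≡ false → rel p d c ≡ false
    outside-p qdc = ¬-not λ pdc → true≢false (p⊑q d _ pdc) qdc

  refineAt-blockwise : {φ : (Fin n → Bool) → Set} → Blockwise φ p → Blockwise φ q → Blockwise φ refineAt
  refineAt-blockwise φp φq a with rel q d a
  ... | true  = φp a
  ... | false = φq a

  refineAt-recovers : (x : Partition n) → rel q d ⊆ rel x d → q ⊑ x ∨ₚ refineAt
  refineAt-recovers x Y⊆X a b qab with rel q d a in qda
  ... | true  = ∨ₚ-upperˡ x refineAt a b (trans x a d b (symm x d a (Y⊆X a qda)) (Y⊆X b qdb))
    where
    qdb : rel q d b ≡ true
    qdb = ≡.trans (sym (membership-≡ q d qab)) qda
  ... | false = ∨ₚ-upperʳ x refineAt a b (≡.trans (outside qda b) qab)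

split-recovers : (D : Fin n → Bool) {x y : Partition n} {d b : Fin n} → x ⊑ y → D ⊆ rel x d →
                 SameBlock x d b → D b ≡ false → y ⊑ x ∨ₚ (y ∧ₚ split D)
split-recovers D {x} {y} {d} {b} x⊑y D⊆X xdb Db = recover
  where
  l : Partition _
  l = y ∧ₚ split D
  same-side : ∀ {a c} → SameBlock y a c → D a ≡ D c → SameBlock (x ∨ₚ l) a c
  same-side {a} {c} yac Da≡Dc = ∨ₚ-upperʳ x l a c (∧-intro yac (split-intro D Da≡Dc))
  crossing : ∀ {a c} → SameBlock y a c → D a ≡ true → D c ≡ false → SameBlock (x ∨ₚ l) a c
  crossing {a} {c} yac Da Dc =
    trans (x ∨ₚ l) a b c (∨ₚ-upperˡ x l a b xab)
      (same-side (trans y b a c (symm y a b (x⊑y a b xab)) yac) (≡.trans Db (sym Dc)))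
    where
    xab : SameBlock x a b
    xab = trans x a d b (symm x d a (D⊆X a Da)) xdb
  recover : y ⊑ x ∨ₚ l
  recover a c yac with D a in Da | D c in Dc
  ... | true  | true  = same-side yac (≡.trans Da (sym Dc))
  ... | false | false = same-side yac (≡.trans Da (sym Dc))
  ... | true  | false = crossing yac Da Dc
  ... | false | true  = symm (x ∨ₚ l) c a (crossing (symm y a c yac) Dc Da)

crossing-edge : (D : Fin n → Bool) {x v : Partition n} → x ⊑ v → ¬ (x ⊑ v ∧ₚ split D) →
                ∃ λ a → ∃ λ b → SameBlock x a b × D a ≡ true × D b ≡ false
crossing-edge D {x} {v} x⊑v x⋢ with ⋢⇒separated {p = x} {v ∧ₚ split D} x⋢
... | a , b , xab , ¬ab =
  orient (λ Da≡Db → true≢false (∧-intro (x⊑v a b xab) (split-intro D Da≡Db)) ¬ab)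
  where
  orient : D a ≢ D b → ∃ λ a → ∃ λ b → SameBlock x a b × D a ≡ true × D b ≡ false
  orient Da≢Db with D a in Da | D b in Db
  ... | true  | false = a , b , xab , Da , Db
  ... | false | true  = b , a , symm x a b xab , Db , Da
  ... | true  | true  = ⊥-elim (Da≢Db refl)
  ... | false | false = ⊥-elim (Da≢Db refl)

argmax-on : {P : Fin n → Set} → Decidable P → (f : Fin n → ℕ) → ∀ {c} → P c →
            Σ (Fin n) λ d → P d × (∀ s → P s → f s ≤ f d)
argmax-on {n} P? f {c} Pc =
  argmax f c candidates ,
  argmax-all f Pc (all-filter P? (allFin n)) ,
  λ s Ps → All.lookup (f[xs]≤f[argmax] c candidates) (∈-filter⁺ P? (∈-allFin s) Ps)
  where
  candidates : List (Fin n)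
  candidates = filter P? (allFin n)

IsPivot : (Fin n → Fin n) → (u v : Partition n) → Fin n → Set
IsPivot aff u v d = ∀ s → SameBlock v d s → blockSize u s ≤ 1 →
                    blockSize u d ≤ 1 × affVal aff s ≤ affVal aff d

IsPivot-⊑ : {aff : Fin n → Fin n} {u v w : Partition n} {d : Fin n} →
            w ⊑ v → IsPivot aff u v d → IsPivot aff u w d
IsPivot-⊑ w⊑v pivot s wds = pivot s (w⊑v _ s wds)

pivot-exists : (aff : Fin n → Fin n) (u v : Partition n) (p : Fin n) →
               Σ (Fin n) λ d → SameBlock v p d × IsPivot aff u v d
pivot-exists {n} aff u v p = choose (any? candidate?)
  where
  Candidate : Fin n → Set
  Candidate s = SameBlock v p s × blockSize u s ≤ 1
  candidate? : Decidable Candidate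
  candidate? s = (rel v p s ≟ᵇ true) ×-dec (blockSize u s ≤? 1)
  choose : Dec (∃ Candidate) → Σ _ λ d → SameBlock v p d × IsPivot aff u v d
  choose (no none) = p , reflx v p , λ s vps us≤1 → ⊥-elim (none (s , vps , us≤1))
  choose (yes (_ , c₀)) with argmax-on candidate? (affVal aff) c₀
  ... | d , (vpd , ud≤1) , maximal =
    d , vpd , λ s vds us≤1 → ud≤1 , maximal s (trans v p d s vpd vds , us≤1)

module Crossing {u x y : Partition n} {d b : Fin n} (u⊑x : u ⊑ x) (x⊑y : x ⊑ y)
                (xdb : SameBlock x d b) (udb : rel u d b ≡ false) where

  u⊑y : u ⊑ y
  u⊑y = ⊑-trans {p = u} {x} {y} u⊑x x⊑y

  S : Fin n → Bool
  S = rel y d ∖ rel u d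

  S⊆Y : S ⊆ rel y d
  S⊆Y c = ∧-elimˡ

  S-outside-D : ∀ {c} → S c ≡ true → rel u d c ≡ false
  S-outside-D Sc = not-injective (∧-elimʳ Sc)

  ∈S : ∀ {c} → SameBlock y d c → rel u d c ≡ false → S c ≡ true
  ∈S ydc udc = ∧-intro ydc (cong not udc)

  u-block⊆S : ∀ {s} → S s ≡ true → rel u s ⊆ S
  u-block⊆S {s} Ss c usc =
    ∈S (trans y d s c (S⊆Y s Ss) (u⊑y s c usc)) (≡.trans (sym (membership-≡ u d usc)) (S-outside-D Ss))

  x-block∖D⊆S : ∀ {c} → SameBlock x d c → rel u d c ≡ false → S c ≡ true
  x-block∖D⊆S {c} xdc = ∈S (x⊑y d c xdc)

  b∈S : S b ≡ true
  b∈S = x-block∖D⊆S xdb udb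

  2≤blockSize-x : 2 ≤ blockSize x d
  2≤blockSize-x = countB-≥2 d b (reflx x d) xdb λ { refl → true≢false (reflx u d) udb }

  blockSize-y : blockSize y d ≡ blockSize u d + countB S
  blockSize-y = ≡.trans (countB-split (rel y d) (rel u d)) (cong (_+ countB S) (countB-cong D≡Y∩D))
    where
    D≡Y∩D : ∀ c → rel y d c ∧ rel u d c ≡ rel u d c
    D≡Y∩D c = ≡true-ext ∧-elimʳ (λ udc → ∧-intro (u⊑y d c udc) udc)

  y-block-⊆-x : blockSize u d ≤ 1 → countB S < blockSize x d → rel y d ⊆ rel x d
  y-block-⊆-x D≤1 S<X =
    countB-⊆-antisym (x⊑y d) (≤-trans (≤-reflexive blockSize-y) (≤-trans (+-mono-≤ D≤1 ≤-refl) S<X))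

  private
    D : Fin n → Bool
    D = rel u d

    l : Partition n
    l = y ∧ₚ split D

    outside-Y : ∀ {c} → rel y d c ≡ false → D c ≡ false
    outside-Y {c} ydc = ¬-not λ udc → true≢false (u⊑y d c udc) ydc

    block-outside-Y : ∀ {c} → rel y d c ≡ false → ∀ b → rel y c b ≡ rel l c b
    block-outside-Y {c} ydc b = ≡true-ext
      (λ ycb → ∧-intro ycb (split-intro D (≡.trans (outside-Y ydc) (sym (outside-Y (ydb ycb))))))
      ∧-elimˡ
      where ydb : SameBlock y c b → rel y d b ≡ false
            ydb ycb = ≡.trans (sym (membership-≡ y d ycb)) ydc

    block-D : ∀ {c} → D c ≡ true → ∀ b → rel u c b ≡ rel l c b
    block-D {c} udc b = ≡true-ext
      (λ ucb → ∧-intro (u⊑y c b ucb) (split-intro D (membership-≡ u d ucb)))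
      (λ lcb → trans u c d b (symm u d c udc) (≡.trans (sym (split-elim D (∧-elimʳ lcb))) udc))

    block-S : ∀ {c} → S c ≡ true → ∀ b → S b ≡ rel l c b
    block-S {c} Sc b = ≡true-ext
      (λ Sb → ∧-intro (trans y c d b (symm y d c (S⊆Y c Sc)) (S⊆Y b Sb))
                      (split-intro D (≡.trans (S-outside-D Sc) (sym (S-outside-D Sb)))))
      (λ lcb → ∈S (trans y d c b (S⊆Y c Sc) (∧-elimˡ lcb))
                  (≡.trans (sym (split-elim D (∧-elimʳ lcb))) (S-outside-D Sc)))

  -- The blocks of y ∧ₚ split D are D, S and the blocks of y other than Y.
  ∧ₚ-split-blockwise : {φ : (Fin n → Bool) → Set} → (∀ {B C} → (∀ i → B i ≡ C i) → φ B → φ C) →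
                       Blockwise φ u → Blockwise φ y → φ S → Blockwise φ (y ∧ₚ split (rel u d))
  ∧ₚ-split-blockwise φ-resp φu φy φS c with rel y d c ≟ᵇ true | D c ≟ᵇ true
  ... | no  ydc≢true | _   = φ-resp (block-outside-Y (¬-not ydc≢true)) (φy c)
  ... | yes _        | yes udc = φ-resp (block-D udc) (φu c)
  ... | yes ydc      | no  udc≢true = φ-resp (block-S (∈S ydc (¬-not udc≢true))) φS

-- Comodernism of a blockwise family

-- The only step of the argument that depends on the admissibility condition.
CrossingBound : (Fin n → Fin n) → ((Fin n → Bool) → Set) → Set
CrossingBound {n} aff φ = ∀ (u x y : Partition n) (d b : Fin n) →
  u ⊑ x → x ⊑ y → SameBlock x d b → rel u d b ≡ false →
  Blockwise φ u → Blockwise φ x → IsPivot aff u y d → ¬ φ (rel y d ∖ rel u d) →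
  blockSize u d ≤ 1 × countB (rel y d ∖ rel u d) < blockSize x d

record BlockCondition (aff : Fin n → Fin n) : Set₁ where
  field
    Admissible     : (Fin n → Bool) → Set
    resp           : ∀ {B C} → (∀ i → B i ≡ C i) → Admissible B → Admissible C
    admissible?    : ∀ B → Dec (Admissible B)
    small          : ∀ {B} → countB B ≤ 1 → Admissible B
    ∨ₚ-closed      : ∀ p q → Blockwise Admissible p → Blockwise Admissible q →
                     Blockwise Admissible (p ∨ₚ q)
    crossing-bound : CrossingBound aff Admissible

module Comodernism (aff : Fin n → Fin n) (C : BlockCondition aff) where

  open BlockCondition C

  Q : Partition n → Set
  Q = Blockwise Admissible

  Q-resp : Q Respects _≈_
  Q-resp {p} {q} p≈q Qp c = resp (≈⇒rel≡ {p = p} {q} p≈q c) (Qp c)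

  Q? : ∀ p → Dec (Q p)
  Q? p = all? λ c → admissible? (rel p c)

  Q-discrete : Q discrete
  Q-discrete a = small (blockSize-discrete a)

  lattice : IsLattice Q
  lattice a b Qa Qb = join , meet
    where
    join : Σ _ (IsJoin Q a b)
    join = a ∨ₚ b , (∨ₚ-closed a b Qa Qb , ∨ₚ-upperˡ a b , ∨ₚ-upperʳ a b) ,
           λ c (_ , a⊑c , b⊑c) → ∨ₚ-least {p = a} {b} {c} a⊑c b⊑c
    meet : Σ _ (IsMeet Q a b)
    meet = greatest {P = IsLB Q a b}
      (λ {p} {q} p≈q (Qp , p⊑a , p⊑b) →
         Q-resp {p} {q} p≈q Qp , ⊑-respˡ a {p} {q} p≈q p⊑a , ⊑-respˡ b {p} {q} p≈q p⊑b)
      (λ p → Q? p ×-dec (p ⊑? a) ×-dec (p ⊑? b))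
      (λ {p} {q} (Qp , p⊑a , p⊑b) (Qq , q⊑a , q⊑b) →
         ∨ₚ-closed p q Qp Qq , ∨ₚ-least {p = p} {q} {a} p⊑a q⊑a , ∨ₚ-least {p = p} {q} {b} p⊑b q⊑b)
      {p₀ = discrete} (Q-discrete , discrete-least a , discrete-least b)

  module Interval {u v : Partition n} (Qu : Q u) (Qv : Q v) (u⊑v : u ⊑ v)
                  {d b₁ : Fin n} (vdb₁ : SameBlock v d b₁) (udb₁ : rel u d b₁ ≡ false)
                  (pivot : IsPivot aff u v d) where

    D : Fin n → Bool
    D = rel u d

    t : Partition n
    t = v ∧ₚ split D

    u⊑t : u ⊑ t
    u⊑t = ∧ₚ-greatest {p = v} {split D} {u} u⊑v (⊑-split-block u d)

    Below-t : Partition n → Set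
    Below-t p = Q p × u ⊑ p × p ⊑ t

    m-greatest : Σ (Partition n) λ m → Below-t m × (∀ p → Below-t p → p ⊑ m)
    m-greatest = greatest {P = Below-t}
      (λ {p} {q} p≈q (Qp , u⊑p , p⊑t) →
         Q-resp {p} {q} p≈q Qp , ⊑-respʳ u {p} {q} p≈q u⊑p , ⊑-respˡ t {p} {q} p≈q p⊑t)
      (λ p → Q? p ×-dec (u ⊑? p) ×-dec (p ⊑? t))
      (λ {p} {q} (Qp , u⊑p , p⊑t) (Qq , _ , q⊑t) →
         ∨ₚ-closed p q Qp Qq , ⊑-trans {p = u} {p} {p ∨ₚ q} u⊑p (∨ₚ-upperˡ p q) ,
         ∨ₚ-least {p = p} {q} {t} p⊑t q⊑t)
      {p₀ = u} (Qu , ⊑-refl {p = u} , u⊑t)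

    m : Partition n
    m = proj₁ m-greatest

    Below-t-m : Below-t m
    Below-t-m = proj₁ (proj₂ m-greatest)

    ⊑m : ∀ p → Below-t p → p ⊑ m
    ⊑m = proj₂ (proj₂ m-greatest)

    complement-below-t : ∀ {x y} → Q x → Q y → u ⊑ x → x ⊑ y → y ⊑ v → ¬ (x ⊑ t) →
                         Σ (Partition n) λ l → Below-t l × l ⊑ y × y ⊑ x ∨ₚ l
    complement-below-t {x} {y} Qx Qy u⊑x x⊑y y⊑v x⋢t
      with crossing-edge D {x} {v} (⊑-trans {p = x} {y} {v} x⊑y y⊑v) x⋢t
    ... | a , b , xab , Da , Db = by-cases (Q? (y ∧ₚ split D))
      where
      xdb : SameBlock x d b
      xdb = trans x d a b (u⊑x d a Da) xab
      open Crossing {u = u} {x = x} {y = y} u⊑x x⊑y xdb Db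
      by-cases : Dec (Q (y ∧ₚ split D)) → Σ (Partition n) λ l → Below-t l × l ⊑ y × y ⊑ x ∨ₚ l
      by-cases (yes Q-y∧D) =
        y ∧ₚ split D , (Q-y∧D , u⊑y∧D , ∧ₚ-monoˡ {p = y} {v} (split D) y⊑v) ,
        ∧ₚ-lowerˡ y (split D) , split-recovers D {x} {y} x⊑y (u⊑x d) xdb Db
        where
        u⊑y∧D : u ⊑ y ∧ₚ split D
        u⊑y∧D = ∧ₚ-greatest {p = y} {split D} {u} u⊑y (⊑-split-block u d)
      by-cases (no ¬Q-y∧D) =
        l , (refineAt-blockwise y u u⊑y d {Admissible} Qu Qy , ⊑-refineAt y u u⊑y d , l⊑t) ,
        refineAt-⊑ y u u⊑y d , refineAt-recovers y u u⊑y d x (uncurry y-block-⊆-x bound)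
        where
        l : Partition n
        l = refineAt y u u⊑y d
        l⊑t : l ⊑ t
        l⊑t = ∧ₚ-greatest {p = v} {split D} {l}
                (⊑-trans {p = l} {y} {v} (refineAt-⊑ y u u⊑y d) y⊑v) (refineAt-⊑-split y u u⊑y d)
        bound : blockSize u d ≤ 1 × countB S < blockSize x d
        bound = crossing-bound u x y d b u⊑x x⊑y xdb Db Qu Qx (IsPivot-⊑ {u = u} {v} {y} y⊑v pivot)
                  (λ Adm-S → ¬Q-y∧D (∧ₚ-split-blockwise {φ = Admissible} resp Qu Qy Adm-S))

    IV : Partition n → Set
    IV = Interval Q u v

    IV-m : IV m
    IV-m = proj₁ Below-t-m , proj₁ (proj₂ Below-t-m) ,
           ⊑-trans {p = m} {t} {v} (proj₂ (proj₂ Below-t-m)) (∧ₚ-lowerˡ v (split D))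

    v⋢m : ¬ (v ⊑ m)
    v⋢m v⊑m = true≢false (≡.trans (sym (split-elim D d~b₁)) (reflx u d)) udb₁
      where
      d~b₁ : SameBlock (split D) d b₁
      d~b₁ = ∧-elimʳ {rel v d b₁} (proj₂ (proj₂ Below-t-m) d b₁ (v⊑m d b₁ vdb₁))

    m⊑v : m ⊑ v
    m⊑v = proj₂ (proj₂ IV-m)

    coatom : IsCoatom IV v m
    coatom = IV-m , (m⊑v , v⋢m) , nothing-between
      where
      nothing-between : ∀ w → IV w → m ⊏ w → ¬ (w ⊏ v)
      nothing-between w (Qw , u⊑w , w⊑v) (m⊑w , w⋢m) (_ , v⋢w) with w ⊑? t
      ... | yes w⊑t = w⋢m (⊑m w (Qw , u⊑w , w⊑t))
      ... | no  w⋢t with complement-below-t {w} {v} Qw Qv u⊑w w⊑v (⊑-refl {p = v}) w⋢t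
      ...   | l , Below-t-l , _ , v⊑w∨l =
        v⋢w (⊑-trans {p = v} {w ∨ₚ l} {w} v⊑w∨l
              (∨ₚ-least {p = w} {l} {w} (⊑-refl {p = w})
                (⊑-trans {p = l} {m} {w} (⊑m l Below-t-l) m⊑w)))

    -- r ⊑ k holds in every lattice; k ⊑ r is where the exchange property enters.
    left-modular : LeftModular IV m
    left-modular x y (Qx , u⊑x , x⊑v) IVy@(Qy , _ , y⊑v) (x⊑y , _) j k l r
                 ((IVj , x⊑j , m⊑j) , j-least) ((IVk , k⊑j , k⊑y) , k-greatest)
                 ((_ , l⊑m , l⊑y) , l-greatest) ((IVr , x⊑r , l⊑r) , r-least) = k⊑r , r⊑k
      where
      r⊑k : r ⊑ k
      r⊑k = k-greatest r (IVr , r-least j (IVj , x⊑j , ⊑-trans {p = l} {m} {j} l⊑m m⊑j) ,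
                                r-least y (IVy , x⊑y , l⊑y))
      k⊑r : k ⊑ r
      k⊑r with x ⊑? m
      ... | yes x⊑m = ⊑-trans {p = k} {l} {r} (l-greatest k (IVk , k⊑m , k⊑y)) l⊑r
        where
        k⊑m : k ⊑ m
        k⊑m = ⊑-trans {p = k} {j} {m} k⊑j (j-least m (IV-m , x⊑m , ⊑-refl {p = m}))
      ... | no  x⋢m
        with complement-below-t {x} {y} Qx Qy u⊑x x⊑y y⊑v (λ x⊑t → x⋢m (⊑m x (Qx , u⊑x , x⊑t)))
      ...   | l′ , Below-t-l′@(Ql′ , u⊑l′ , l′⊑t) , l′⊑y , y⊑x∨l′ =
        ⊑-trans {p = k} {y} {r} k⊑y
          (⊑-trans {p = y} {x ∨ₚ l′} {r} y⊑x∨l′ (∨ₚ-least {p = x} {l′} {r} x⊑r l′⊑r))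
        where
        l′⊑v : l′ ⊑ v
        l′⊑v = ⊑-trans {p = l′} {t} {v} l′⊑t (∧ₚ-lowerˡ v (split D))
        l′⊑l : l′ ⊑ l
        l′⊑l = l-greatest l′ ((Ql′ , u⊑l′ , l′⊑v) , ⊑m l′ Below-t-l′ , l′⊑y)
        l′⊑r : l′ ⊑ r
        l′⊑r = ⊑-trans {p = l′} {l} {r} l′⊑l l⊑r

  -- p lies in a block of v that is not a block of u; d is its pivot, and b₁ lies in
  -- that block outside the u-block of d.
  left-modular-coatom : ∀ u v → Q u → Q v → u ⊏ v →
                        Σ _ λ m → IsCoatom (Interval Q u v) v m × LeftModular (Interval Q u v) m
  left-modular-coatom u v Qu Qv (u⊑v , v⋢u) with ⋢⇒separated {p = v} {u} v⋢u
  ... | p , q , vpq , upq with pivot-exists aff u v p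
  ...   | d , vpd , pivot = witness (escaping (rel u d p ≟ᵇ true))
    where
    escaping : Dec (rel u d p ≡ true) → ∃ λ b₁ → SameBlock v d b₁ × rel u d b₁ ≡ false
    escaping (yes udp) = q , trans v d p q (symm v p d vpd) vpq ,
                         ¬-not λ udq → true≢false (trans u p d q (symm u d p udp) udq) upq
    escaping (no udp≢true) = p , symm v p d vpd , ¬-not udp≢true
    witness : (∃ λ b₁ → SameBlock v d b₁ × rel u d b₁ ≡ false) →
              Σ _ λ m → IsCoatom (Interval Q u v) v m × LeftModular (Interval Q u v) m
    witness (b₁ , vdb₁ , udb₁) = m , coatom , left-modular
      where open Interval {u} {v} Qu Qv u⊑v vdb₁ udb₁ pivot

  comodernistic : Comodernistic Q
  comodernistic = lattice , left-modular-coatom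

-- The two families

-- PiExists aff and PiForall aff unfold to Blockwise Admissible∃ and Blockwise Admissible∀.
module _ (aff : Fin n → Fin n) where

  Admissible∃ : (Fin n → Bool) → Set
  Admissible∃ B = 2 ≤ countB B → ∃ λ y → B y ≡ true × affVal aff y ≤ countB B

  Admissible∃-resp : ∀ {B C} → (∀ i → B i ≡ C i) → Admissible∃ B → Admissible∃ C
  Admissible∃-resp B≗C adm 2≤C with adm (subst (2 ≤_) (sym (countB-cong B≗C)) 2≤C)
  ... | y , By , aff≤B =
    y , ≡.trans (sym (B≗C y)) By , subst (affVal aff y ≤_) (countB-cong B≗C) aff≤B

  admissible∃? : ∀ B → Dec (Admissible∃ B)
  admissible∃? B = (2 ≤? countB B) →-dec any? λ y → (B y ≟ᵇ true) ×-dec (affVal aff y ≤? countB B)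

  Admissible∃-small : ∀ {B} → countB B ≤ 1 → Admissible∃ B
  Admissible∃-small B≤1 2≤B = ⊥-elim (<⇒≱ 2≤B B≤1)

  ∨ₚ-closed∃ : ∀ p q → Blockwise Admissible∃ p → Blockwise Admissible∃ q →
               Blockwise Admissible∃ (p ∨ₚ q)
  ∨ₚ-closed∃ p q adm-p adm-q a 2≤ with ∨ₚ-nontrivial p q a 2≤
  ... | inj₁ 2≤p with adm-p a 2≤p
  ...   | y , pay , aff≤ =
    y , ∨ₚ-upperˡ p q a y pay , ≤-trans aff≤ (blockSize-mono {p = p} {p ∨ₚ q} (∨ₚ-upperˡ p q) a)
  ∨ₚ-closed∃ p q adm-p adm-q a 2≤ | inj₂ 2≤q with adm-q a 2≤q
  ...   | y , qay , aff≤ =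
    y , ∨ₚ-upperʳ p q a y qay , ≤-trans aff≤ (blockSize-mono {p = q} {p ∨ₚ q} (∨ₚ-upperʳ p q) a)

  crossing-bound∃ : CrossingBound aff Admissible∃
  crossing-bound∃ u x y d b u⊑x x⊑y xdb udb adm-u adm-x pivot ¬adm-S = D≤1 , S<X
    where
    open Crossing {u = u} {x = x} {y = y} u⊑x x⊑y xdb udb
    S<aff : ∀ {w} → S w ≡ true → countB S < affVal aff w
    S<aff {w} Sw = ≰⇒> λ aff≤S → ¬adm-S λ _ → w , Sw , aff≤S
    u-singleton : ∀ {s} → S s ≡ true → blockSize u s ≤ 1
    u-singleton {s} Ss with 2 ≤? blockSize u s
    ... | no  2≰ = ≤-pred (≰⇒> 2≰)
    ... | yes 2≤ with adm-u s 2≤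
    ...   | w , usw , aff≤ =
      ⊥-elim (<⇒≱ (S<aff (u-block⊆S Ss w usw)) (≤-trans aff≤ (countB-mono (u-block⊆S Ss))))
    pivot-b : blockSize u d ≤ 1 × affVal aff b ≤ affVal aff d
    pivot-b = pivot b (S⊆Y b b∈S) (u-singleton b∈S)
    D≤1 : blockSize u d ≤ 1
    D≤1 = proj₁ pivot-b
    S<X : countB S < blockSize x d
    S<X with adm-x d 2≤blockSize-x
    ... | w , xdw , aff≤ with rel u d w ≟ᵇ true
    ...   | no  udw≢true = <-≤-trans (S<aff (x-block∖D⊆S xdw (¬-not udw≢true))) aff≤
    ...   | yes udw = <-≤-trans (S<aff b∈S) (≤-trans (proj₂ pivot-b) aff-d≤X)
      where
      aff-d≤X : affVal aff d ≤ blockSize x d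
      aff-d≤X = subst (λ z → affVal aff z ≤ blockSize x d)
                  (sym (countB≤1⇒unique D≤1 d w (reflx u d) udw)) aff≤

  ∃-condition : BlockCondition aff
  ∃-condition = record
    { Admissible = Admissible∃ ; resp = Admissible∃-resp ; admissible? = admissible∃?
    ; small = Admissible∃-small ; ∨ₚ-closed = ∨ₚ-closed∃ ; crossing-bound = crossing-bound∃ }

  Admissible∀ : (Fin n → Bool) → Set
  Admissible∀ B = 2 ≤ countB B → ∀ y → B y ≡ true → affVal aff y ≤ countB B

  Admissible∀-resp : ∀ {B C} → (∀ i → B i ≡ C i) → Admissible∀ B → Admissible∀ C
  Admissible∀-resp B≗C adm 2≤C y Cy =
    subst (affVal aff y ≤_) (countB-cong B≗C)
      (adm (subst (2 ≤_) (sym (countB-cong B≗C)) 2≤C) y (≡.trans (B≗C y) Cy))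

  admissible∀? : ∀ B → Dec (Admissible∀ B)
  admissible∀? B = (2 ≤? countB B) →-dec all? λ y → (B y ≟ᵇ true) →-dec (affVal aff y ≤? countB B)

  Admissible∀-small : ∀ {B} → countB B ≤ 1 → Admissible∀ B
  Admissible∀-small B≤1 2≤B = ⊥-elim (<⇒≱ 2≤B B≤1)

  ∨ₚ-closed∀ : ∀ p q → Blockwise Admissible∀ p → Blockwise Admissible∀ q →
               Blockwise Admissible∀ (p ∨ₚ q)
  ∨ₚ-closed∀ p q adm-p adm-q a 2≤ y ay =
    subst (affVal aff y ≤_) (sym (blockSize-≡ (p ∨ₚ q) ay))
      (bound (∨ₚ-nontrivial p q y (subst (2 ≤_) (blockSize-≡ (p ∨ₚ q) ay) 2≤)))
    where
    bound : 2 ≤ blockSize p y ⊎ 2 ≤ blockSize q y → affVal aff y ≤ blockSize (p ∨ₚ q) y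
    bound (inj₁ 2≤p) =
      ≤-trans (adm-p y 2≤p y (reflx p y)) (blockSize-mono {p = p} {p ∨ₚ q} (∨ₚ-upperˡ p q) y)
    bound (inj₂ 2≤q) =
      ≤-trans (adm-q y 2≤q y (reflx q y)) (blockSize-mono {p = q} {p ∨ₚ q} (∨ₚ-upperʳ p q) y)

  crossing-bound∀ : CrossingBound aff Admissible∀
  crossing-bound∀ u x y d b u⊑x x⊑y xdb udb adm-u adm-x pivot ¬adm-S = D≤1 , S<X
    where
    open Crossing {u = u} {x = x} {y = y} u⊑x x⊑y xdb udb
    large : ∃ λ w → S w ≡ true × countB S < affVal aff w
    large with any? (λ w → (S w ≟ᵇ true) ×-dec (countB S <? affVal aff w))
    ... | yes found = found
    ... | no  none  = ⊥-elim (¬adm-S λ _ w Sw → ≮⇒≥ λ S<aff → none (w , Sw , S<aff))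
    w : Fin n
    w = proj₁ large
    Sw : S w ≡ true
    Sw = proj₁ (proj₂ large)
    S<aff : countB S < affVal aff w
    S<aff = proj₂ (proj₂ large)
    u-singleton : blockSize u w ≤ 1
    u-singleton with 2 ≤? blockSize u w
    ... | no  2≰ = ≤-pred (≰⇒> 2≰)
    ... | yes 2≤ = ⊥-elim (<⇒≱ S<aff (≤-trans (adm-u w 2≤ w (reflx u w)) (countB-mono (u-block⊆S Sw))))
    pivot-w : blockSize u d ≤ 1 × affVal aff w ≤ affVal aff d
    pivot-w = pivot w (S⊆Y w Sw) u-singleton
    D≤1 : blockSize u d ≤ 1
    D≤1 = proj₁ pivot-w
    S<X : countB S < blockSize x d
    S<X = <-≤-trans S<aff (≤-trans (proj₂ pivot-w) (adm-x d 2≤blockSize-x d (reflx x d)))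

  ∀-condition : BlockCondition aff
  ∀-condition = record
    { Admissible = Admissible∀ ; resp = Admissible∀-resp ; admissible? = admissible∀?
    ; small = Admissible∀-small ; ∨ₚ-closed = ∨ₚ-closed∀ ; crossing-bound = crossing-bound∀ }

theorem6p3 : (n : ℕ) → 1 ≤ n → (aff : Fin n → Fin n) →
    Comodernistic (PiExists aff) × Comodernistic (PiForall aff)
theorem6p3 n _ aff =
  Comodernism.comodernistic aff (∃-condition aff) , Comodernism.comodernistic aff (∀-condition aff)
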